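{- Let $n=3$ and $d\in\mathbb{R}^{3}$ (coordinates $d(1,2),d(1,3),d(2,3)$). Then the output $x$ of the UPGMA algorithm on $d$ is a least squares equidistant tree vector: $\sum_{1\le i<j\le 3}(d(i,j)-x(i,j))^2\le \sum_{1\le i<j\le 3}(d(i,j)-y(i,j))^2$ for every $y\in\mathbb{R}^3$ such that the maximum of $\{y(1,2),y(1,3),y(2,3)\}$ is attained at least twice.
   Context: A vector $y\in\mathbb{R}^{\binom{n}{2}}$ (coordinates indexed by pairs $i<j$ in $[n]$) is the distance vector of an equidistant tree (rooted edge-weighted tree with leaves labeled by $[n]$, all leaves at equal distance from the root) exactly when for all distinct $i,j,k$ the maximum of $\{y(i,j),y(i,k),y(j,k)\}$ is attained at least twice. UPGMA algorithm: start with the partition of $[n]$ into singletons. While there is more than one block: among all pairs of distinct current blocks $S,T$, choose one minimizing $\frac{1}{|S||T|}\sum_{i\in S,\,j\in T} d(i,j)$; set $x(i,j)$ equal to this minimal average for all $i\in S$, $j\in T$; replace $S,T$ by $S\cup T$. The resulting $x$ is the output. -}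

module Defs where

open import Level using (Level; _⊔_) renaming (suc to lsuc)
open import Algebra.Bundles using (CommutativeRing)
open import Relation.Binary.Structures using (IsTotalOrder)
open import Relation.Nullary using (¬_)
open import Data.Product using (_×_)
open import Data.Sum using (_⊎_)

-- An ordered field: a commutative ring with 1 ≉ 0 in which every nonzero
-- element has a multiplicative inverse, equipped with a total order
-- compatible with addition and multiplication.  (ℝ is an example; by
-- Tarski's transfer principle a universal statement holds over ℝ iff it
-- holds over every ordered field.)
record OrderedField (c ℓ₁ ℓ₂ : Level) : Set (lsuc (c ⊔ ℓ₁ ⊔ ℓ₂)) where
  field
    commutativeRing : CommutativeRing c ℓ₁
  open CommutativeRing commutativeRing public
  field
    _≤_         : Carrier → Carrier → Set ℓ₂
    isTotalOrder : IsTotalOrder _≈_ _≤_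
    1≉0         : ¬ (1# ≈ 0#)
    _⁻¹         : (x : Carrier) → ¬ (x ≈ 0#) → Carrier
    ⁻¹-inverse  : (x : Carrier) (p : ¬ (x ≈ 0#)) → x * (_⁻¹ x p) ≈ 1#
    +-mono-≤    : ∀ {x y} z → x ≤ y → (x + z) ≤ (y + z)
    *-nonneg    : ∀ {x y} → 0# ≤ x → 0# ≤ y → 0# ≤ (x * y)

  infixl 6 _−_
  _−_ : Carrier → Carrier → Carrier
  x − y = x + (- y)

  sq : Carrier → Carrier
  sq x = x * x

  two : Carrier
  two = 1# + 1#

record Vec3 {c} (A : Set c) : Set c where
  constructor ⟨_,_,_⟩
  field
    v12 v13 v23 : A

module _ {c ℓ₁ ℓ₂} (F : OrderedField c ℓ₁ ℓ₂) where
  open OrderedField F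
  open Vec3

  -- "m is the average (a + b)/2", written without division: 2·m = a + b.
  IsAverage2 : Carrier → Carrier → Carrier → Set ℓ₁
  IsAverage2 m a b = two * m ≈ a + b

  -- The UPGMA algorithm for n = 3, as a relation  UPGMA d x  ("x is an
  -- output of UPGMA on d" -- ties in the choice of the minimizing pair may
  -- be broken arbitrarily).  Step 1: all blocks are singletons, so the
  -- average distance between {i} and {j} is d(i,j); a minimizing pair {i,j}
  -- is merged and x(i,j) = d(i,j).  Step 2: the blocks {i,j} and {k}
  -- remain; their average distance is (d(i,k) + d(j,k))/2, which is assigned
  -- to x(i,k) and x(j,k).
  data UPGMA (d x : Vec3 Carrier) : Set (ℓ₁ ⊔ ℓ₂) where
    merge12 : v12 d ≤ v13 d → v12 d ≤ v23 d →
              v12 x ≈ v12 d →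
              IsAverage2 (v13 x) (v13 d) (v23 d) →
              IsAverage2 (v23 x) (v13 d) (v23 d) → UPGMA d x
    merge13 : v13 d ≤ v12 d → v13 d ≤ v23 d →
              v13 x ≈ v13 d →
              IsAverage2 (v12 x) (v12 d) (v23 d) →
              IsAverage2 (v23 x) (v12 d) (v23 d) → UPGMA d x
    merge23 : v23 d ≤ v12 d → v23 d ≤ v13 d →
              v23 x ≈ v23 d →
              IsAverage2 (v12 x) (v12 d) (v13 d) →
              IsAverage2 (v13 x) (v12 d) (v13 d) → UPGMA d x

  MaxTwice : Vec3 Carrier → Set (ℓ₁ ⊔ ℓ₂)
  MaxTwice y =
      (v12 y ≈ v13 y × v23 y ≤ v12 y)
    ⊎ (v12 y ≈ v23 y × v13 y ≤ v12 y)
    ⊎ (v13 y ≈ v23 y × v12 y ≤ v13 y)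

  sqDist : Vec3 Carrier → Vec3 Carrier → Carrier
  sqDist d y = sq (v12 d − v12 y) + sq (v13 d − v13 y) + sq (v23 d − v23 y)

module Submission where

-- Suppose UPGMA first merges the closest pair, say with distance p, and then
-- joins it to the third taxon at height m = (q + r)/2, where q, r ≥ p are the
-- two remaining distances.  Its error is  spread q r m = (q - m)² + (r - m)².
-- Let y be equidistant, i.e. its maximum is attained twice.  Two facts give
-- the bound  spread q r m ≤ ‖d - y‖²:
--   * the mean minimises the squared error:  spread q r m ≤ spread q r t
--     for every t (`mean-minimises`);
--   * if y's maximum s is attained at p and at q (say), with y's value
--     yr ≤ s at r, then (r - s)² ≤ (p - s)² + (r - yr)² (`tie-bound`):
--     either yr ≤ s ≤ r, so s is closer to r than yr is, or p ≤ r ≤ s, so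
--     s is closer to r than to p.
--   Taking t = s, the remaining case (maximum attained at q and r) being
--   immediate, this bounds spread q r m by ‖d - y‖² (`cluster-bound`).

open import Defs
open import Data.Product using (_,_)
open import Data.Sum using (inj₁; inj₂)
open import Relation.Nullary using (¬_)
open import Relation.Binary.Bundles using (Poset)
open import Relation.Binary.Structures using (IsTotalOrder)
import Relation.Binary.Reasoning.PartialOrder as ≤-Reasoning
import Algebra.Properties.Ring as RingProperties
import Algebra.Properties.AbelianGroup as AbelianGroupProperties
import Algebra.Solver.CommutativeMonoid as CommutativeMonoidSolver
import Algebra.Solver.Ring.NaturalCoefficients.Default as SemiringSolver

module Development {c ℓ₁ ℓ₂} (F : OrderedField c ℓ₁ ℓ₂) where
  open OrderedField F
  open Vec3
  open RingProperties ring using (-‿distribʳ-*; x[y-z]≈xy-xz)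
  open AbelianGroupProperties +-abelianGroup
    using (⁻¹-∙-comm; ⁻¹-involutive; ⁻¹-anti-homo‿-; ε⁻¹≈ε)
  open CommutativeMonoidSolver +-commutativeMonoid
    using (_⊕_; _⊜_) renaming (solve to +-solve)
  open SemiringSolver commutativeSemiring
    using (_:+_; _:*_; _:=_) renaming (solve to semiring-solve)

  module ≤ = IsTotalOrder isTotalOrder

  poset : Poset c ℓ₁ ℓ₂
  poset = record { isPartialOrder = ≤.isPartialOrder }

  open ≤-Reasoning poset

  telescope : ∀ a b e → (a − b) + (b − e) ≈ a − e
  telescope a b e = begin-equality
    (a + - b) + (b + - e)  ≈⟨ +-solve 4 (λ x -y y -z → (x ⊕ -y) ⊕ (y ⊕ -z) ⊜ (x ⊕ -z) ⊕ (y ⊕ -y)) refl a (- b) b (- e) ⟩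
    (a + - e) + (b + - b)  ≈⟨ +-congˡ (-‿inverseʳ b) ⟩
    (a + - e) + 0#         ≈⟨ +-identityʳ _ ⟩
    a + - e                ∎

  minus-plus : ∀ a b → (a − b) + b ≈ a
  minus-plus a b = begin-equality
    (a + - b) + b  ≈⟨ +-assoc a (- b) b ⟩
    a + (- b + b)  ≈⟨ +-congˡ (-‿inverseˡ b) ⟩
    a + 0#         ≈⟨ +-identityʳ a ⟩
    a              ∎

  two-times : ∀ m → two * m ≈ m + m
  two-times m = trans (distribʳ m 1# 1#) (+-cong (*-identityˡ m) (*-identityˡ m))

  deviations-cancel : ∀ {m q r} → IsAverage2 F m q r → (q − m) + (r − m) ≈ 0#
  deviations-cancel {m} {q} {r} avg = begin-equality
    (q + - m) + (r + - m)  ≈⟨ +-solve 4 (λ x y -z -w → (x ⊕ -z) ⊕ (y ⊕ -w) ⊜ (x ⊕ y) ⊕ (-z ⊕ -w)) refl q r (- m) (- m) ⟩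
    (q + r) + (- m + - m)  ≈⟨ +-cong (trans (sym avg) (two-times m)) (⁻¹-∙-comm m m) ⟩
    (m + m) + - (m + m)    ≈⟨ -‿inverseʳ (m + m) ⟩
    0#                     ∎

  sq-cong : ∀ {a b} → a ≈ b → sq a ≈ sq b
  sq-cong e = *-cong e e

  sq-neg : ∀ x → sq (- x) ≈ sq x
  sq-neg x = begin-equality
    - x * - x        ≈⟨ -‿distribʳ-* (- x) x ⟨
    - (- x * x)      ≈⟨ -‿cong (*-comm (- x) x) ⟩
    - (x * - x)      ≈⟨ -‿cong (-‿distribʳ-* x x) ⟨
    - (- (x * x))    ≈⟨ ⁻¹-involutive (x * x) ⟩
    x * x            ∎

  sq-swap : ∀ a b → sq (a − b) ≈ sq (b − a)
  sq-swap a b = trans (sym (sq-neg (a − b))) (sq-cong (⁻¹-anti-homo‿- a b))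

  sq-zero : ∀ {a b} → a ≈ b → sq (a − b) ≈ 0#
  sq-zero {a} {b} e = trans (*-congʳ d≈0) (zeroˡ (a − b))
    where
      d≈0 : (a − b) ≈ 0#
      d≈0 = trans (+-congʳ e) (-‿inverseʳ b)

  expand-shift : ∀ u v s →
    sq (u + s) + sq (v + s) ≈ (sq u + sq v) + (s * (u + v) + s * (u + v)) + (sq s + sq s)
  expand-shift = semiring-solve 3 (λ u v s →
    (u :+ s) :* (u :+ s) :+ (v :+ s) :* (v :+ s) :=
    (u :* u :+ v :* v) :+ (s :* (u :+ v) :+ s :* (u :+ v)) :+ (s :* s :+ s :* s)) refl

  +-monoˡ : ∀ {a b} z → a ≤ b → (z + a) ≤ (z + b)
  +-monoˡ {a} {b} z a≤b = begin
    z + a  ≈⟨ +-comm z a ⟩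
    a + z  ≤⟨ +-mono-≤ z a≤b ⟩
    b + z  ≈⟨ +-comm b z ⟩
    z + b  ∎

  +-mono : ∀ {a b e f} → a ≤ b → e ≤ f → (a + e) ≤ (b + f)
  +-mono {b = b} {e = e} a≤b e≤f = ≤.trans (+-mono-≤ e a≤b) (+-monoˡ b e≤f)

  nonneg-+ : ∀ {a b} → 0# ≤ a → 0# ≤ b → 0# ≤ (a + b)
  nonneg-+ 0≤a 0≤b = ≤.trans (≤.reflexive (sym (+-identityʳ 0#))) (+-mono 0≤a 0≤b)

  ≤-+-nonneg : ∀ a {p} → 0# ≤ p → a ≤ (a + p)
  ≤-+-nonneg a {p} 0≤p = begin
    a       ≈⟨ +-identityʳ a ⟨
    a + 0#  ≤⟨ +-monoˡ a 0≤p ⟩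
    a + p   ∎

  ≤-nonneg-+ : ∀ a {p} → 0# ≤ p → a ≤ (p + a)
  ≤-nonneg-+ a 0≤p = ≤.trans (≤-+-nonneg a 0≤p) (≤.reflexive (+-comm a _))

  ≤⇒diff-nonneg : ∀ {a b} → a ≤ b → 0# ≤ (b − a)
  ≤⇒diff-nonneg {a} {b} a≤b = begin
    0#       ≈⟨ -‿inverseʳ a ⟨
    a + - a  ≤⟨ +-mono-≤ (- a) a≤b ⟩
    b + - a  ∎

  diff-nonneg⇒≤ : ∀ {a b} → 0# ≤ (b − a) → a ≤ b
  diff-nonneg⇒≤ {a} {b} 0≤b-a = begin
    a               ≤⟨ ≤-nonneg-+ a 0≤b-a ⟩
    (b − a) + a     ≈⟨ minus-plus b a ⟩
    b               ∎

  neg-antitone : ∀ {a b} → a ≤ b → (- b) ≤ (- a)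
  neg-antitone {a} {b} a≤b = diff-nonneg⇒≤ (begin
    0#                ≤⟨ ≤⇒diff-nonneg a≤b ⟩
    b + - a           ≈⟨ +-comm b (- a) ⟩
    - a + b           ≈⟨ +-congˡ (⁻¹-involutive b) ⟨
    - a + - (- b)     ∎)

  sq-nonneg : ∀ x → 0# ≤ sq x
  sq-nonneg x with ≤.total 0# x
  ... | inj₁ 0≤x = *-nonneg 0≤x 0≤x
  ... | inj₂ x≤0 = begin
    0#        ≤⟨ *-nonneg 0≤-x 0≤-x ⟩
    sq (- x)  ≈⟨ sq-neg x ⟩
    sq x      ∎
    where
      0≤-x : 0# ≤ (- x)
      0≤-x = ≤.trans (≤.reflexive (sym ε⁻¹≈ε)) (neg-antitone x≤0)

  *-monoˡ-nonneg : ∀ {z a b} → 0# ≤ z → a ≤ b → (z * a) ≤ (z * b)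
  *-monoˡ-nonneg {z} {a} {b} 0≤z a≤b = diff-nonneg⇒≤ (begin
    0#               ≤⟨ *-nonneg 0≤z (≤⇒diff-nonneg a≤b) ⟩
    z * (b − a)      ≈⟨ x[y-z]≈xy-xz z b a ⟩
    z * b − z * a    ∎)

  sq-mono : ∀ {u v} → 0# ≤ u → u ≤ v → sq u ≤ sq v
  sq-mono {u} {v} 0≤u u≤v = begin
    u * u  ≤⟨ *-monoˡ-nonneg 0≤u u≤v ⟩
    u * v  ≈⟨ *-comm u v ⟩
    v * u  ≤⟨ *-monoˡ-nonneg (≤.trans 0≤u u≤v) u≤v ⟩
    v * v  ∎

  sq-dist-mono : ∀ {a b q} → b ≤ a → a ≤ q → sq (q − a) ≤ sq (q − b)
  sq-dist-mono {a} {b} {q} b≤a a≤q =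
    sq-mono (≤⇒diff-nonneg a≤q) (+-monoˡ q (neg-antitone b≤a))

  two≉0 : ¬ (two ≈ 0#)
  two≉0 two≈0 = 1≉0 (≤.antisym 1≤0 0≤1)
    where
      0≤1 : 0# ≤ 1#
      0≤1 = ≤.trans (sq-nonneg 1#) (≤.reflexive (*-identityˡ 1#))
      1≤0 : 1# ≤ 0#
      1≤0 = begin
        1#        ≈⟨ +-identityʳ 1# ⟨
        1# + 0#   ≤⟨ +-monoˡ 1# 0≤1 ⟩
        two       ≈⟨ two≈0 ⟩
        0#        ∎

  cancel-two : ∀ {u v} → two * u ≈ two * v → u ≈ v
  cancel-two {u} {v} e = begin-equality
    u                ≈⟨ *-identityˡ u ⟨
    1# * u           ≈⟨ *-congʳ half·two ⟨
    (half * two) * u ≈⟨ *-assoc half two u ⟩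
    half * (two * u) ≈⟨ *-congˡ e ⟩
    half * (two * v) ≈⟨ *-assoc half two v ⟨
    (half * two) * v ≈⟨ *-congʳ half·two ⟩
    1# * v           ≈⟨ *-identityˡ v ⟩
    v                ∎
    where
      half : Carrier
      half = _⁻¹ two two≉0
      half·two : half * two ≈ 1#
      half·two = trans (*-comm half two) (⁻¹-inverse two two≉0)

  average-unique : ∀ {m m' a b} → IsAverage2 F m a b → IsAverage2 F m' a b → m ≈ m'
  average-unique avg avg' = cancel-two (trans avg (sym avg'))

  spread : Carrier → Carrier → Carrier → Carrier
  spread q r t = sq (q − t) + sq (r − t)

  spread-comm : ∀ q r t → spread q r t ≈ spread r q t
  spread-comm q r t = +-comm (sq (q − t)) (sq (r − t))

  -- The mean minimises the squared error: the cross term of the expansion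
  -- around m vanishes and what remains is a sum of squares.
  mean-minimises : ∀ {m q r} → IsAverage2 F m q r → ∀ t → spread q r m ≤ spread q r t
  mean-minimises {m} {q} {r} avg t = begin
    sq u + sq v                                               ≤⟨ ≤-+-nonneg _ (nonneg-+ (sq-nonneg s) (sq-nonneg s)) ⟩
    (sq u + sq v) + (sq s + sq s)                             ≈⟨ +-congʳ (+-identityʳ _) ⟨
    (sq u + sq v) + 0# + (sq s + sq s)                        ≈⟨ +-congʳ (+-congˡ cross≈0) ⟨
    (sq u + sq v) + (s * (u + v) + s * (u + v)) + (sq s + sq s) ≈⟨ expand-shift u v s ⟨
    sq (u + s) + sq (v + s)                                   ≈⟨ +-cong (sq-cong (telescope q m t)) (sq-cong (telescope r m t)) ⟩
    spread q r t                                              ∎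
    where
      u v s : Carrier
      u = q − m
      v = r − m
      s = m − t
      half-cross≈0 : s * (u + v) ≈ 0#
      half-cross≈0 = trans (*-congˡ (deviations-cancel avg)) (zeroʳ s)
      cross≈0 : s * (u + v) + s * (u + v) ≈ 0#
      cross≈0 = trans (+-cong half-cross≈0 half-cross≈0) (+-identityʳ 0#)

  tie-bound : ∀ {p r s yr} → p ≤ r → yr ≤ s → sq (r − s) ≤ (sq (p − s) + sq (r − yr))
  tie-bound {p} {r} {s} {yr} p≤r yr≤s with ≤.total s r
  ... | inj₁ s≤r = begin
    sq (r − s)                 ≤⟨ sq-dist-mono yr≤s s≤r ⟩
    sq (r − yr)                ≤⟨ ≤-nonneg-+ _ (sq-nonneg (p − s)) ⟩
    sq (p − s) + sq (r − yr)   ∎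
  ... | inj₂ r≤s = begin
    sq (r − s)                 ≈⟨ sq-swap r s ⟩
    sq (s − r)                 ≤⟨ sq-dist-mono p≤r r≤s ⟩
    sq (s − p)                 ≈⟨ sq-swap s p ⟩
    sq (p − s)                 ≤⟨ ≤-+-nonneg _ (sq-nonneg (r − yr)) ⟩
    sq (p − s) + sq (r − yr)   ∎

  outgroup-tie : ∀ {p q r m s yr} → p ≤ r → IsAverage2 F m q r → yr ≤ s →
    spread q r m ≤ (sq (p − s) + sq (q − s) + sq (r − yr))
  outgroup-tie {p} {q} {r} {m} {s} {yr} p≤r avg yr≤s = begin
    spread q r m                              ≤⟨ mean-minimises avg s ⟩
    sq (q − s) + sq (r − s)                   ≤⟨ +-monoˡ _ (tie-bound p≤r yr≤s) ⟩
    sq (q − s) + (sq (p − s) + sq (r − yr))   ≈⟨ +-solve 3 (λ a b e → a ⊕ (b ⊕ e) ⊜ (b ⊕ a) ⊕ e) refl _ _ _ ⟩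
    sq (p − s) + sq (q − s) + sq (r − yr)     ∎

  cluster-bound : ∀ {p q r m yp yq yr} → p ≤ q → p ≤ r → IsAverage2 F m q r →
    MaxTwice F ⟨ yp , yq , yr ⟩ → spread q r m ≤ sqDist F ⟨ p , q , r ⟩ ⟨ yp , yq , yr ⟩
  cluster-bound {p} {q} {r} {m} {yp} {yq} {yr} _ p≤r avg (inj₁ (yp≈yq , yr≤yp)) = begin
    spread q r m                               ≤⟨ outgroup-tie p≤r avg (≤.trans yr≤yp (≤.reflexive yp≈yq)) ⟩
    sq (p − yq) + sq (q − yq) + sq (r − yr)    ≈⟨ +-congʳ (+-congʳ (sq-cong (+-congˡ (-‿cong yp≈yq)))) ⟨
    sqDist F ⟨ p , q , r ⟩ ⟨ yp , yq , yr ⟩    ∎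
  cluster-bound {p} {q} {r} {m} {yp} {yq} {yr} p≤q _ avg (inj₂ (inj₁ (yp≈yr , yq≤yp))) = begin
    spread q r m                               ≈⟨ spread-comm q r m ⟩
    spread r q m                               ≤⟨ outgroup-tie p≤q (trans avg (+-comm q r)) (≤.trans yq≤yp (≤.reflexive yp≈yr)) ⟩
    sq (p − yr) + sq (r − yr) + sq (q − yq)    ≈⟨ +-solve 3 (λ a b e → (a ⊕ b) ⊕ e ⊜ (a ⊕ e) ⊕ b) refl _ _ _ ⟩
    sq (p − yr) + sq (q − yq) + sq (r − yr)    ≈⟨ +-congʳ (+-congʳ (sq-cong (+-congˡ (-‿cong yp≈yr)))) ⟨
    sqDist F ⟨ p , q , r ⟩ ⟨ yp , yq , yr ⟩    ∎
  cluster-bound {p} {q} {r} {m} {yp} {yq} {yr} _ _ avg (inj₂ (inj₂ (yq≈yr , _))) = begin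
    spread q r m                               ≤⟨ mean-minimises avg yq ⟩
    sq (q − yq) + sq (r − yq)                  ≈⟨ +-congˡ (sq-cong (+-congˡ (-‿cong yq≈yr))) ⟩
    sq (q − yq) + sq (r − yr)                  ≤⟨ +-mono-≤ _ (≤-nonneg-+ _ (sq-nonneg (p − yp))) ⟩
    sq (p − yp) + sq (q − yq) + sq (r − yr)    ∎

  merged-first-optimal : ∀ {d x} → v12 d ≤ v13 d → v12 d ≤ v23 d → v12 x ≈ v12 d →
    IsAverage2 F (v13 x) (v13 d) (v23 d) → IsAverage2 F (v23 x) (v13 d) (v23 d) →
    ∀ y → MaxTwice F y → sqDist F d x ≤ sqDist F d y
  merged-first-optimal {d} {x} p≤q p≤r x12≈d12 avg₁₃ avg₂₃ y maxTwice = begin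
    sqDist F d x                        ≈⟨ +-congʳ (+-congʳ (sq-zero (sym x12≈d12))) ⟩
    0# + sq (q − v13 x) + sq (r − v23 x) ≈⟨ +-congʳ (+-identityˡ _) ⟩
    sq (q − v13 x) + sq (r − v23 x)      ≈⟨ +-congˡ (sq-cong (+-congˡ (-‿cong (average-unique avg₁₃ avg₂₃)))) ⟨
    spread q r (v13 x)                   ≤⟨ cluster-bound p≤q p≤r avg₁₃ maxTwice ⟩
    sqDist F d y                         ∎
    where
      q r : Carrier
      q = v13 d
      r = v23 d

  -- Transposing leaves 2 and 3 swaps the coordinates
  -- (1,2) and (1,3); a cyclic relabelling of the leaves moves (2,3) to
  -- the front.

  swap23 : ∀ {a} {A : Set a} → Vec3 A → Vec3 A
  swap23 v = ⟨ v13 v , v12 v , v23 v ⟩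

  cycle : ∀ {a} {A : Set a} → Vec3 A → Vec3 A
  cycle v = ⟨ v23 v , v12 v , v13 v ⟩

  swap23-MaxTwice : ∀ y → MaxTwice F y → MaxTwice F (swap23 y)
  swap23-MaxTwice y (inj₁ (a≈b , c≤a))        = inj₁ (sym a≈b , ≤.trans c≤a (≤.reflexive a≈b))
  swap23-MaxTwice y (inj₂ (inj₁ (a≈c , b≤a))) = inj₂ (inj₂ (a≈c , b≤a))
  swap23-MaxTwice y (inj₂ (inj₂ (b≈c , a≤b))) = inj₂ (inj₁ (b≈c , a≤b))

  cycle-MaxTwice : ∀ y → MaxTwice F y → MaxTwice F (cycle y)
  cycle-MaxTwice y (inj₁ (a≈b , c≤a))        = inj₂ (inj₂ (a≈b , c≤a))
  cycle-MaxTwice y (inj₂ (inj₁ (a≈c , b≤a))) = inj₁ (sym a≈c , ≤.trans b≤a (≤.reflexive a≈c))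
  cycle-MaxTwice y (inj₂ (inj₂ (b≈c , a≤b))) = inj₂ (inj₁ (sym b≈c , ≤.trans a≤b (≤.reflexive b≈c)))

  swap23-sqDist : ∀ d y → sqDist F (swap23 d) (swap23 y) ≈ sqDist F d y
  swap23-sqDist d y = +-solve 3 (λ a b e → (b ⊕ a) ⊕ e ⊜ (a ⊕ b) ⊕ e) refl _ _ _

  cycle-sqDist : ∀ d y → sqDist F (cycle d) (cycle y) ≈ sqDist F d y
  cycle-sqDist d y = +-solve 3 (λ a b e → (e ⊕ a) ⊕ b ⊜ (a ⊕ b) ⊕ e) refl _ _ _

  relabel-optimal : (σ : Vec3 Carrier → Vec3 Carrier) →
    (∀ y → MaxTwice F y → MaxTwice F (σ y)) → (∀ d y → sqDist F (σ d) (σ y) ≈ sqDist F d y) →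
    ∀ {d x} → (∀ y → MaxTwice F y → sqDist F (σ d) (σ x) ≤ sqDist F (σ d) y) →
    ∀ y → MaxTwice F y → sqDist F d x ≤ sqDist F d y
  relabel-optimal σ σ-MaxTwice σ-sqDist {d} {x} optimal y maxTwice = begin
    sqDist F d x              ≈⟨ σ-sqDist d x ⟨
    sqDist F (σ d) (σ x)      ≤⟨ optimal (σ y) (σ-MaxTwice y maxTwice) ⟩
    sqDist F (σ d) (σ y)      ≈⟨ σ-sqDist d y ⟩
    sqDist F d y              ∎

corollary2p4 : ∀ {c ℓ₁ ℓ₂} (F : OrderedField c ℓ₁ ℓ₂) →
    let open OrderedField F in
    (d x : Vec3 Carrier) → UPGMA F d x →
    (y : Vec3 Carrier) → MaxTwice F y →
    sqDist F d x ≤ sqDist F d y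
corollary2p4 F d x (merge12 p≤q p≤r x≈d avg avg′) =
  merged-first-optimal p≤q p≤r x≈d avg avg′
  where open Development F
corollary2p4 F d x (merge13 p≤q p≤r x≈d avg avg′) =
  relabel-optimal swap23 swap23-MaxTwice swap23-sqDist
    (merged-first-optimal p≤q p≤r x≈d avg avg′)
  where open Development F
corollary2p4 F d x (merge23 p≤q p≤r x≈d avg avg′) =
  relabel-optimal cycle cycle-MaxTwice cycle-sqDist
    (merged-first-optimal p≤q p≤r x≈d avg avg′)
  where open Development F
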